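{- Let $k$ be a nonnegative integer. Then $${\rm ord}_2(t^e_{4k})=2\left\lfloor\frac{k+1}{2}\right\rfloor=k+\chi_o(k).$$
   Context: $t^e_n$ is the number of involutions of $[n]$ (permutations with $\pi^2=1$) having an even number of 2-cycles, with $t^e_0=1$. $\chi_o(k)=1$ if $k$ is odd and $0$ otherwise. ${\rm ord}_2(m)$ is the largest integer $e$ with $2^e\mid m$. -}

module Defs where

open import Data.Nat using (ℕ; zero; suc; _+_; _*_; _^_; _<_; _<?_; _/_)
open import Data.Nat.Divisibility using (_∣_; _∣?_)
open import Data.Fin using (Fin; toℕ)
open import Data.Fin.Properties using (all?; _≟_)
open import Data.List using (List; [_]; map; concatMap; length; filter; allFin)
open import Data.Vec.Functional using () renaming (_∷_ to _∷ᶠ_)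
open import Data.Product using (_×_)
open import Relation.Nullary using (¬_; Dec)
open import Relation.Nullary.Decidable using (_×-dec_)
open import Relation.Binary.PropositionalEquality using (_≡_)

allFuns : (m n : ℕ) → List (Fin m → Fin n)
allFuns zero    n = [ (λ ()) ]
allFuns (suc m) n = concatMap (λ x → map (λ g → x ∷ᶠ g) (allFuns m n)) (allFin n)

-- π is an involution of [n] : π ∘ π = id  (such a map is automatically a permutation)
IsInvolution : {n : ℕ} → (Fin n → Fin n) → Set
IsInvolution {n} π = ∀ (i : Fin n) → π (π i) ≡ i

isInvolution? : {n : ℕ} → (π : Fin n → Fin n) → Dec (IsInvolution π)
isInvolution? π = all? (λ i → π (π i) ≟ i)

-- number of 2-cycles of an involution π: each 2-cycle {i, π i} is counted once,
-- at its smaller element i (i < π i)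
twoCycles : {n : ℕ} → (Fin n → Fin n) → ℕ
twoCycles {n} π = length (filter (λ i → toℕ i <? toℕ (π i)) (allFin n))

IsEvenInvolution : {n : ℕ} → (Fin n → Fin n) → Set
IsEvenInvolution π = IsInvolution π × (2 ∣ twoCycles π)

-- t^e_n : number of involutions of [n] with an even number of 2-cycles
-- (for n = 0 this counts the empty function, giving t^e_0 = 1)
tᵉ : ℕ → ℕ
tᵉ n = length (filter (λ π → isInvolution? π ×-dec (2 ∣? twoCycles π)) (allFuns n n))

χₒ : ℕ → ℕ
χₒ zero          = 0
χₒ (suc zero)    = 1
χₒ (suc (suc k)) = χₒ k

Ord₂ : ℕ → ℕ → Set
Ord₂ m e = (2 ^ e ∣ m) × ¬ (2 ^ suc e ∣ m)

-- Let e_n and o_n count the involutions of [n] with an even, resp. odd, number of 2-cycles.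
-- Classifying by the image of the point 0 (a fixed point, or one of n + 1 partners in a 2-cycle)
-- gives e_{n+2} = e_{n+1} + (n+1) o_n and o_{n+2} = o_{n+1} + (n+1) e_n, so the total count
-- e + o and the signed count e − o satisfy u_{n+2} = u_{n+1} ± (n+1) u_n.  Iterating such a
-- recurrence four times from an even index pulls out a factor 2, so at 4k and 4k+1 both counts
-- are 2^k times odd numbers whose residues mod 8 depend only on k mod 4.  Finally
-- 2 tᵉ_{4k} = (e + o)_{4k} + (e − o)_{4k}, and the two odd parts sum to 2 (mod 4) for even k
-- and to 4 (mod 8) for odd k.
module Submission where

open import Defs

module Involutions where

  open import Level using (0ℓ)
  open import Data.Nat using (ℕ; zero; suc; _+_; _*_; _<_; _<?_; s≤s; parity)
  import Data.Nat.Properties as ℕ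
  open import Data.Nat.Divisibility using (_∣_; divides)
  open import Data.Parity.Base using (Parity; 0ℙ; _⁻¹)
  import Data.Parity.Properties as ℙ
  open import Data.Bool using (if_then_else_)
  open import Data.Fin using (Fin; zero; suc; toℕ; punchIn; punchOut)
  open import Data.Fin.Properties
    using (0≢1+n; suc-injective; punchIn-injective; punchInᵢ≢i; punchIn-mono-≤; punchIn-cancel-≤;
           punchIn-punchOut)
    renaming (_≟_ to _≟ᶠ_)
  open import Data.List as List using (List; [_]; _++_; length; filter; map; concat; tabulate; allFin)
  open import Data.List.Properties using (filter-++; filter-≐; filter-none; length-++; map-tabulate)
  import Data.List.Relation.Unary.All as All
  open import Data.Vec.Functional using (_∷_; insertAt)
  open import Data.Vec.Functional.Properties using (insertAt-lookup; insertAt-punchIn)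
  open import Algebra.Properties.CommutativeMonoid.Sum ℕ.+-0-commutativeMonoid
    using (sum; sum-syntax; sum-remove; sum-cong-≗; sum-replicate-zero)
  open import Data.Product using (_×_; _,_)
  open import Function using (_∘_; id; _⇔_; mk⇔; Equivalence)
  open import Relation.Nullary using (¬_; Dec; does; yes; no; contradiction)
  open import Relation.Nullary.Decidable using (_×-dec_)
  open import Relation.Unary using (Pred; Decidable)
  open import Relation.Binary.Definitions using (_Respects_)
  open import Relation.Binary.PropositionalEquality
    using (_≡_; _≢_; _≗_; refl; sym; trans; cong; cong₂; subst; module ≡-Reasoning)
  open ≡-Reasoning

  𝟙 : ∀ {A : Set} → Dec A → ℕ
  𝟙 a? = if does a? then 1 else 0

  𝟙-⇔ : ∀ {A B : Set} (a? : Dec A) (b? : Dec B) → (A → B) → (B → A) → 𝟙 a? ≡ 𝟙 b?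
  𝟙-⇔ a? b? to from with a? | b?
  ... | yes _ | yes _ = refl
  ... | no _  | no _  = refl
  ... | yes a | no ¬b = contradiction (to a) ¬b
  ... | no ¬a | yes b = contradiction (from b) ¬a

  ∑-const : ∀ n c → ∑[ i < n ] c ≡ n * c
  ∑-const zero    c = refl
  ∑-const (suc n) c = cong (c +_) (∑-const n c)

  module _ {A : Set} {P : Pred A 0ℓ} (P? : Decidable P) where

    length-filter-singleton : ∀ x → length (filter P? [ x ]) ≡ 𝟙 (P? x)
    length-filter-singleton x with P? x
    ... | yes _ = refl
    ... | no _  = refl

    length-filter-tabulate : ∀ {n} (f : Fin n → A) →
                             length (filter P? (tabulate f)) ≡ ∑[ i < n ] 𝟙 (P? (f i))
    length-filter-tabulate {zero}  f = refl
    length-filter-tabulate {suc n} f with P? (f zero)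
    ... | yes _ = cong suc (length-filter-tabulate (f ∘ suc))
    ... | no _  = length-filter-tabulate (f ∘ suc)

    length-filter-concat : ∀ {n} (xss : Fin n → List A) →
      length (filter P? (concat (tabulate xss))) ≡ ∑[ i < n ] length (filter P? (xss i))
    length-filter-concat {zero}  xss = refl
    length-filter-concat {suc n} xss = begin
      length (filter P? (xss zero ++ rest))
        ≡⟨ cong length (filter-++ P? (xss zero) rest) ⟩
      length (filter P? (xss zero) ++ filter P? rest)
        ≡⟨ length-++ (filter P? (xss zero)) ⟩
      length (filter P? (xss zero)) + length (filter P? rest)
        ≡⟨ cong (length (filter P? (xss zero)) +_) (length-filter-concat (xss ∘ suc)) ⟩
      ∑[ i < suc n ] length (filter P? (xss i)) ∎
      where rest = concat (tabulate (xss ∘ suc))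

  length-filter-map : ∀ {A B : Set} {P : Pred B 0ℓ} (P? : Decidable P) (f : A → B) (xs : List A) →
                      length (filter P? (map f xs)) ≡ length (filter (P? ∘ f) xs)
  length-filter-map P? f List.[]         = refl
  length-filter-map P? f (x List.∷ xs) with P? (f x)
  ... | yes _ = cong suc (length-filter-map P? f xs)
  ... | no _  = length-filter-map P? f xs

  ∷-cong : ∀ {A : Set} {n} (x : A) {g h : Fin n → A} → g ≗ h → (x ∷ g) ≗ (x ∷ h)
  ∷-cong x g≗h zero    = refl
  ∷-cong x g≗h (suc i) = g≗h i

  insertAt-cong : ∀ {A : Set} {n} (j : Fin (suc n)) (c : A) {g h : Fin n → A} →
                  g ≗ h → insertAt g j c ≗ insertAt h j c
  insertAt-cong zero              c g≗h zero    = refl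
  insertAt-cong zero              c g≗h (suc i) = g≗h i
  insertAt-cong {n = suc n} (suc j) c g≗h zero    = g≗h zero
  insertAt-cong {n = suc n} (suc j) c g≗h (suc i) = insertAt-cong j c (g≗h ∘ suc) i

  Map : ℕ → ℕ → Set
  Map m n = Fin m → Fin n

  count : ∀ {m n} {P : Pred (Map m n) 0ℓ} → Decidable P → ℕ
  count {m} {n} P? = length (filter P? (allFuns m n))

  module _ {m n : ℕ} where

    count-⇔ : ∀ {P Q : Pred (Map m n) 0ℓ} (P? : Decidable P) (Q? : Decidable Q) →
              (∀ f → P f ⇔ Q f) → count P? ≡ count Q?
    count-⇔ P? Q? P⇔Q = cong length (filter-≐ P? Q?
      ((λ {f} → Equivalence.to (P⇔Q f)) , (λ {f} → Equivalence.from (P⇔Q f))) (allFuns m n))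

    count-none : ∀ {P : Pred (Map m n) 0ℓ} (P? : Decidable P) → (∀ f → ¬ P f) → count P? ≡ 0
    count-none P? ¬P = cong length (filter-none P? (All.universal ¬P (allFuns m n)))

  -- Maps built from the same values in different ways are only pointwise equal, which is why the
  -- predicates below are required to respect _≗_.
  count-cong-∘ : ∀ {m n m′ n′} {P : Pred (Map m n) 0ℓ} (P? : Decidable P) → P Respects _≗_ →
                 (F G : Map m′ n′ → Map m n) → (∀ h → F h ≗ G h) → count (P? ∘ F) ≡ count (P? ∘ G)
  count-cong-∘ P? resp F G F≗G = count-⇔ _ _ λ h → mk⇔ (resp (F≗G h)) (resp (sym ∘ F≗G h))

  count-cons : ∀ {m n} {P : Pred (Map (suc m) n) 0ℓ} (P? : Decidable P) →
               count P? ≡ ∑[ x < n ] count (λ g → P? (x ∷ g))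
  count-cons {m} {n} P? = begin
    length (filter P? (concat (map cons-with (tabulate id))))
      ≡⟨ cong (length ∘ filter P? ∘ concat) (map-tabulate id cons-with) ⟩
    length (filter P? (concat (tabulate cons-with)))
      ≡⟨ length-filter-concat P? cons-with ⟩
    ∑[ x < n ] length (filter P? (cons-with x))
      ≡⟨ sum-cong-≗ (λ x → length-filter-map P? (x ∷_) (allFuns m n)) ⟩
    ∑[ x < n ] count (λ g → P? (x ∷ g)) ∎
    where
    cons-with : Fin n → List (Map (suc m) n)
    cons-with x = map (x ∷_) (allFuns m n)

  count-punchIn : ∀ {m n} {P : Pred (Map m (suc n)) 0ℓ} (P? : Decidable P) (c : Fin (suc n)) →
                  P Respects _≗_ → (∀ {f} → P f → ∀ i → f i ≢ c) →
                  count P? ≡ count (λ h → P? (punchIn c ∘ h))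
  count-punchIn {zero} P? c resp avoids = begin
    length (filter P? [ _ ])          ≡⟨ length-filter-singleton P? _ ⟩
    𝟙 (P? _)                          ≡⟨ 𝟙-⇔ (P? _) (P? _) (resp (λ ())) (resp (λ ())) ⟩
    𝟙 (P? (punchIn c ∘ _))            ≡⟨ length-filter-singleton (λ h → P? (punchIn c ∘ h)) _ ⟨
    count (λ h → P? (punchIn c ∘ h))  ∎
  count-punchIn {suc m} {n} P? c resp avoids = begin
    count P?
      ≡⟨ count-cons P? ⟩
    ∑[ x < suc n ] count (λ g → P? (x ∷ g))
      ≡⟨ sum-remove {i = c} (λ x → count (λ g → P? (x ∷ g))) ⟩
    count (λ g → P? (c ∷ g)) + ∑[ y < n ] count (λ g → P? (punchIn c y ∷ g))
      ≡⟨ cong₂ _+_ (count-none (λ g → P? (c ∷ g)) (λ g p → avoids p zero refl))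
                   (sum-cong-≗ λ y → count-punchIn (λ g → P? (punchIn c y ∷ g)) c
                                                   (resp ∘ ∷-cong _) (λ p → avoids p ∘ suc)) ⟩
    ∑[ y < n ] count (λ h → P? (punchIn c y ∷ (punchIn c ∘ h)))
      ≡⟨ sum-cong-≗ (λ y → count-cong-∘ P? resp (λ h → punchIn c y ∷ (punchIn c ∘ h))
                                                 (λ h → punchIn c ∘ (y ∷ h))
                                                 (λ h → λ { zero → refl ; (suc i) → refl })) ⟩
    ∑[ y < n ] count (λ h → P? (punchIn c ∘ (y ∷ h)))
      ≡⟨ count-cons (λ h → P? (punchIn c ∘ h)) ⟨
    count (λ h → P? (punchIn c ∘ h)) ∎

  count-insertAt : ∀ {m n} {P : Pred (Map (suc m) n) 0ℓ} (P? : Decidable P) (j : Fin (suc m))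
                   (c : Fin n) → P Respects _≗_ → (∀ {f} → P f → f j ≡ c) →
                   count P? ≡ count (λ h → P? (insertAt h j c))
  count-insertAt {m} {suc n} P? zero c resp fixes = begin
    count P?
      ≡⟨ count-cons P? ⟩
    ∑[ x < suc n ] count (λ g → P? (x ∷ g))
      ≡⟨ sum-remove {i = c} (λ x → count (λ g → P? (x ∷ g))) ⟩
    count (λ g → P? (c ∷ g)) + ∑[ y < n ] count (λ g → P? (punchIn c y ∷ g))
      ≡⟨ cong (count (λ g → P? (c ∷ g)) +_) (trans
           (sum-cong-≗ λ y → count-none (λ g → P? (punchIn c y ∷ g)) (λ g p → punchInᵢ≢i c y (fixes p)))
           (sum-replicate-zero n)) ⟩
    count (λ g → P? (c ∷ g)) + 0
      ≡⟨ ℕ.+-identityʳ _ ⟩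
    count (λ g → P? (c ∷ g))
      ≡⟨ count-cong-∘ P? resp (c ∷_) (λ h → insertAt h zero c)
                              (λ h → λ { zero → refl ; (suc i) → refl }) ⟩
    count (λ h → P? (insertAt h zero c)) ∎
  count-insertAt {suc m} {n} P? (suc j) c resp fixes = begin
    count P?
      ≡⟨ count-cons P? ⟩
    ∑[ x < n ] count (λ g → P? (x ∷ g))
      ≡⟨ sum-cong-≗ (λ x → count-insertAt (λ g → P? (x ∷ g)) j c (resp ∘ ∷-cong x) fixes) ⟩
    ∑[ x < n ] count (λ h → P? (x ∷ insertAt h j c))
      ≡⟨ sum-cong-≗ (λ x → count-cong-∘ P? resp (λ h → x ∷ insertAt h j c)
                                                 (λ h → insertAt (x ∷ h) (suc j) c)
                                                 (λ h → λ { zero → refl ; (suc i) → refl })) ⟩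
    ∑[ x < n ] count (λ h → P? (insertAt (x ∷ h) (suc j) c))
      ≡⟨ count-cons (λ h → P? (insertAt h (suc j) c)) ⟨
    count (λ h → P? (insertAt h (suc j) c)) ∎

  punchIn-mono-< : ∀ {n} (j : Fin (suc n)) {x y : Fin n} →
                   toℕ x < toℕ y → toℕ (punchIn j x) < toℕ (punchIn j y)
  punchIn-mono-< j {x} {y} x<y = ℕ.≰⇒> (ℕ.<⇒≱ x<y ∘ punchIn-cancel-≤ j y x)

  punchIn-cancel-< : ∀ {n} (j : Fin (suc n)) {x y : Fin n} →
                     toℕ (punchIn j x) < toℕ (punchIn j y) → toℕ x < toℕ y
  punchIn-cancel-< j {x} {y} p = ℕ.≰⇒> (ℕ.<⇒≱ p ∘ punchIn-mono-≤ j y x)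

  parity-suc : ∀ t → parity (suc t) ≡ parity t ⁻¹
  parity-suc zero          = refl
  parity-suc (suc zero)    = refl
  parity-suc (suc (suc t)) = parity-suc t

  parity-suc-≡⇔ : ∀ t p → parity (suc t) ≡ p ⇔ parity t ≡ p ⁻¹
  parity-suc-≡⇔ t p = mk⇔ (λ eq → sym (ℙ.⁻¹-selfInverse (trans (sym (parity-suc t)) eq)))
                          (λ eq → trans (parity-suc t) (ℙ.⁻¹-selfInverse (sym eq)))

  2∣⇔parity≡0ℙ : ∀ t → 2 ∣ t ⇔ parity t ≡ 0ℙ
  2∣⇔parity≡0ℙ t = mk⇔ (λ { (divides q refl) → parity-even q }) (even t)
    where
    parity-even : ∀ q → parity (q * 2) ≡ 0ℙ
    parity-even zero    = refl
    parity-even (suc q) = parity-even q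
    even : ∀ t → parity t ≡ 0ℙ → 2 ∣ t
    even zero          _  = divides 0 refl
    even (suc (suc t)) eq with even t eq
    ... | divides q t≡q*2 = divides (suc q) (cong (2 +_) t≡q*2)

  module _ {n : ℕ} where

    twoCycles-cong : {f g : Fin n → Fin n} → f ≗ g → twoCycles f ≡ twoCycles g
    twoCycles-cong f≗g = cong length (filter-≐ _ _
      ((λ {i} → subst (λ v → toℕ i < toℕ v) (f≗g i)) ,
       (λ {i} → subst (λ v → toℕ i < toℕ v) (sym (f≗g i))))
      (allFin n))

    twoCycles-∑ : (π : Fin n → Fin n) → twoCycles π ≡ ∑[ i < n ] 𝟙 (toℕ i <? toℕ (π i))
    twoCycles-∑ π = length-filter-tabulate (λ i → toℕ i <? toℕ (π i)) id

    IsInvolution-resp : IsInvolution {n} Respects _≗_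
    IsInvolution-resp {f} {g} f≗g inv i = trans (cong g (sym (f≗g i))) (trans (sym (f≗g (f i))) (inv i))

  WithParity : ∀ {n} → Parity → (Fin n → Fin n) → Set
  WithParity p π = IsInvolution π × parity (twoCycles π) ≡ p

  WithParity-resp : ∀ {n} p → WithParity {n} p Respects _≗_
  WithParity-resp p f≗g (inv , par) =
    IsInvolution-resp f≗g inv , trans (cong parity (sym (twoCycles-cong f≗g))) par

  module _ {n : ℕ} (h : Fin n → Fin n) where

    fix0 : Fin (suc n) → Fin (suc n)
    fix0 = zero ∷ (suc ∘ h)

    fix0-WithParity : ∀ p → WithParity p fix0 ⇔ WithParity p h
    fix0-WithParity p = mk⇔
      (λ (inv , par) → (λ i → suc-injective (inv (suc i))) ,
                       trans (cong parity (sym twoCycles-fix0)) par)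
      (λ (inv , par) → (λ { zero → refl ; (suc i) → cong suc (inv i) }) ,
                       trans (cong parity twoCycles-fix0) par)
      where
      -- Term by term: 0 is not an excedance, and suc i <? suc (h i) computes to i <? h i.
      twoCycles-fix0 : twoCycles fix0 ≡ twoCycles h
      twoCycles-fix0 = trans (twoCycles-∑ fix0) (sym (twoCycles-∑ h))

  module _ {n : ℕ} (j : Fin (suc n)) (h : Fin n → Fin n) where

    -- The 2-cycle (0, j+1) together with h acting on the remaining points, relabelled by punchIn j.
    swap0 : Fin (suc (suc n)) → Fin (suc (suc n))
    swap0 = suc j ∷ insertAt (suc ∘ punchIn j ∘ h) j zero

    swap0-j : swap0 (suc j) ≡ zero
    swap0-j = insertAt-lookup (suc ∘ punchIn j ∘ h) j zero

    swap0-punchIn : ∀ i → swap0 (suc (punchIn j i)) ≡ suc (punchIn j (h i))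
    swap0-punchIn = insertAt-punchIn (suc ∘ punchIn j ∘ h) j zero

    swap0-involution : IsInvolution swap0 ⇔ IsInvolution h
    swap0-involution = mk⇔ restrict extend
      where
      restrict : IsInvolution swap0 → IsInvolution h
      restrict inv i = punchIn-injective j _ _ (suc-injective (begin
        suc (punchIn j (h (h i)))          ≡⟨ swap0-punchIn (h i) ⟨
        swap0 (suc (punchIn j (h i)))      ≡⟨ cong swap0 (swap0-punchIn i) ⟨
        swap0 (swap0 (suc (punchIn j i)))  ≡⟨ inv (suc (punchIn j i)) ⟩
        suc (punchIn j i)                  ∎))
      extend-punchIn : IsInvolution h → ∀ i → swap0 (swap0 (suc (punchIn j i))) ≡ suc (punchIn j i)
      extend-punchIn inv i = begin
        swap0 (swap0 (suc (punchIn j i)))  ≡⟨ cong swap0 (swap0-punchIn i) ⟩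
        swap0 (suc (punchIn j (h i)))      ≡⟨ swap0-punchIn (h i) ⟩
        suc (punchIn j (h (h i)))          ≡⟨ cong (suc ∘ punchIn j) (inv i) ⟩
        suc (punchIn j i)                  ∎
      extend : IsInvolution h → IsInvolution swap0
      extend inv zero = swap0-j
      extend inv (suc k) with j ≟ᶠ k
      ... | yes refl = cong swap0 swap0-j
      ... | no j≢k   = subst (λ k → swap0 (swap0 (suc k)) ≡ suc k) (punchIn-punchOut j≢k)
                             (extend-punchIn inv (punchOut j≢k))

    twoCycles-swap0 : twoCycles swap0 ≡ suc (twoCycles h)
    twoCycles-swap0 = begin
      twoCycles swap0
        ≡⟨ twoCycles-∑ swap0 ⟩
      suc (∑[ i < suc n ] exceeds (suc i))
        ≡⟨ cong suc (sum-remove {i = j} (exceeds ∘ suc)) ⟩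
      suc (exceeds (suc j) + ∑[ i < n ] exceeds (suc (punchIn j i)))
        ≡⟨ cong suc (cong₂ _+_ (cong (λ v → 𝟙 (suc (toℕ j) <? toℕ v)) swap0-j)
                               (sum-cong-≗ exceeds-punchIn)) ⟩
      suc (∑[ i < n ] 𝟙 (toℕ i <? toℕ (h i)))
        ≡⟨ cong suc (twoCycles-∑ h) ⟨
      suc (twoCycles h) ∎
      where
      exceeds : Fin (suc (suc n)) → ℕ
      exceeds i = 𝟙 (toℕ i <? toℕ (swap0 i))
      exceeds-punchIn : ∀ i → exceeds (suc (punchIn j i)) ≡ 𝟙 (toℕ i <? toℕ (h i))
      exceeds-punchIn i = 𝟙-⇔ (suc (toℕ (punchIn j i)) <? toℕ (swap0 (suc (punchIn j i))))
                              (toℕ i <? toℕ (h i))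
        (λ lt → punchIn-cancel-< j (ℕ.≤-pred (subst (exceeded-by (punchIn j i)) (swap0-punchIn i) lt)))
        (λ lt → subst (exceeded-by (punchIn j i)) (sym (swap0-punchIn i)) (s≤s (punchIn-mono-< j lt)))
        where
        exceeded-by : Fin (suc n) → Fin (suc (suc n)) → Set
        exceeded-by x v = suc (toℕ x) < toℕ v

    swap0-WithParity : ∀ p → WithParity p swap0 ⇔ WithParity (p ⁻¹) h
    swap0-WithParity p = mk⇔
      (λ (inv , par) → Equivalence.to swap0-involution inv ,
                       Equivalence.to parity-shift (trans (cong parity (sym twoCycles-swap0)) par))
      (λ (inv , par) → Equivalence.from swap0-involution inv ,
                       trans (cong parity twoCycles-swap0) (Equivalence.from parity-shift par))
      where parity-shift = parity-suc-≡⇔ (twoCycles h) p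

  withParity? : ∀ {n} p → Decidable (WithParity {n} p)
  withParity? p π = isInvolution? π ×-dec (parity (twoCycles π) ℙ.≟ p)

  involutions : Parity → ℕ → ℕ
  involutions p n = count (withParity? {n} p)

  involutions-rec : ∀ p n →
                    involutions p (2 + n) ≡ involutions p (1 + n) + (1 + n) * involutions (p ⁻¹) n
  involutions-rec p n = begin
    involutions p (2 + n)
      ≡⟨ count-cons (withParity? {2 + n} p) ⟩
    starting-with zero + ∑[ j < suc n ] starting-with (suc j)
      ≡⟨ cong₂ _+_ fixed-point (sum-cong-≗ two-cycle) ⟩
    involutions p (1 + n) + ∑[ j < suc n ] involutions (p ⁻¹) n
      ≡⟨ cong (involutions p (1 + n) +_) (∑-const (suc n) _) ⟩
    involutions p (1 + n) + (1 + n) * involutions (p ⁻¹) n ∎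
    where
    starting-with : Fin (2 + n) → ℕ
    starting-with x = count {1 + n} {2 + n} (λ g → withParity? p (x ∷ g))

    resp : ∀ {m} → WithParity {m} p Respects _≗_
    resp = WithParity-resp p

    fixed-point : starting-with zero ≡ involutions p (1 + n)
    fixed-point = begin
      starting-with zero
        ≡⟨ count-punchIn {1 + n} {1 + n} (λ g → withParity? p (zero ∷ g)) zero
                         (resp ∘ ∷-cong zero) avoids-0 ⟩
      count {1 + n} (λ h → withParity? p (fix0 h))
        ≡⟨ count-⇔ {1 + n} {1 + n} (λ h → withParity? p (fix0 h)) (withParity? p)
                   (λ h → fix0-WithParity h p) ⟩
      involutions p (1 + n) ∎
      where
      avoids-0 : ∀ {g} → WithParity p (zero ∷ g) → ∀ i → g i ≢ zero
      avoids-0 {g} (inv , _) i gi≡0 = 0≢1+n (trans (cong (zero ∷ g) (sym gi≡0)) (inv (suc i)))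

    two-cycle : ∀ j → starting-with (suc j) ≡ involutions (p ⁻¹) n
    two-cycle j = begin
      starting-with (suc j)
        ≡⟨ count-insertAt {n} {2 + n} (λ g → withParity? p (suc j ∷ g)) j zero
                          (resp ∘ ∷-cong (suc j)) (λ (inv , _) → inv zero) ⟩
      count {n} {2 + n} (λ h → withParity? p (suc j ∷ insertAt h j zero))
        ≡⟨ count-punchIn {n} {1 + n} (λ h → withParity? p (suc j ∷ insertAt h j zero)) zero
                         (resp ∘ ∷-cong (suc j) ∘ insertAt-cong j zero) avoids-0 ⟩
      count {n} {1 + n} (λ h → withParity? p (suc j ∷ insertAt (suc ∘ h) j zero))
        ≡⟨ count-punchIn {n} {n} (λ h → withParity? p (suc j ∷ insertAt (suc ∘ h) j zero)) j
                         (λ h≗h′ → resp (∷-cong (suc j) (insertAt-cong j zero (cong suc ∘ h≗h′))))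
                         avoids-j ⟩
      count {n} (λ h → withParity? p (swap0 j h))
        ≡⟨ count-⇔ {n} {n} (λ h → withParity? p (swap0 j h)) (withParity? (p ⁻¹))
                   (λ h → swap0-WithParity j h p) ⟩
      involutions (p ⁻¹) n ∎
      where
      avoids-0 : ∀ {h} → WithParity p (suc j ∷ insertAt h j zero) → ∀ i → h i ≢ zero
      avoids-0 {h} (inv , _) i hi≡0 = punchInᵢ≢i j i (sym (suc-injective (begin
        suc j                          ≡⟨ cong π (trans (insertAt-punchIn h j zero i) hi≡0) ⟨
        π (π (suc (punchIn j i)))      ≡⟨ inv (suc (punchIn j i)) ⟩
        suc (punchIn j i)              ∎)))
        where π = suc j ∷ insertAt h j zero
      avoids-j : ∀ {h} → WithParity p (suc j ∷ insertAt (suc ∘ h) j zero) → ∀ i → h i ≢ j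
      avoids-j {h} (inv , _) i hi≡j = 0≢1+n (begin
        zero
          ≡⟨ insertAt-lookup (suc ∘ h) j zero ⟨
        π (suc j)
          ≡⟨ cong π (trans (insertAt-punchIn (suc ∘ h) j zero i) (cong suc hi≡j)) ⟨
        π (π (suc (punchIn j i)))
          ≡⟨ inv (suc (punchIn j i)) ⟩
        suc (punchIn j i) ∎)
        where π = suc j ∷ insertAt (suc ∘ h) j zero

  tᵉ≡involutions : ∀ n → tᵉ n ≡ involutions 0ℙ n
  tᵉ≡involutions n = count-⇔ {n} {n} _ (withParity? 0ℙ) λ π →
    mk⇔ (λ (inv , even) → inv , Equivalence.to (2∣⇔parity≡0ℙ (twoCycles π)) even)
        (λ (inv , even) → inv , Equivalence.from (2∣⇔parity≡0ℙ (twoCycles π)) even)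

module TwoAdic where

  open Involutions using (involutions; involutions-rec)
  open import Data.Nat as ℕ using (ℕ; zero; suc)
  import Data.Nat.Properties as ℕ
  import Data.Nat.Divisibility as ℕᵈ
  open import Data.Nat.Tactic.RingSolver using () renaming (solve-∀ to ℕ-solve-∀)
  open import Data.Parity.Base using (0ℙ; 1ℙ; _⁻¹)
  open import Data.Integer using (ℤ; +_; -_; _+_; _-_; _*_; _^_; ∣_∣)
  import Data.Integer.Properties as ℤ
  open import Data.Integer.Divisibility.Signed
    using (_∣_; _∣?_; divides; ∣-trans; ∣m∣n⇒∣m+n; ∣m∣n⇒∣m-n; ∣n⇒∣m*n; ∣⇒∣ᵤ; ∣ᵤ⇒∣)
  open import Data.Integer.Tactic.RingSolver using (solve-∀; solve)
  open import Data.List using (_∷_; [])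
  open import Data.Product using (_×_; _,_; proj₁; proj₂; ∃-syntax)
  open import Relation.Nullary using (¬_; contradiction)
  open import Relation.Nullary.Decidable using (True; toWitness)
  open import Relation.Binary.PropositionalEquality
    using (_≡_; refl; sym; trans; cong; cong₂; subst; module ≡-Reasoning)
  open ≡-Reasoning

  infix 4 _≡_mod_

  -- A record rather than m ∣ x - y directly, so that x, y and m can be inferred.
  record _≡_mod_ (x y m : ℤ) : Set where
    constructor mod-∣
    field ∣-difference : m ∣ x - y

  mod-decide : ∀ {x y m} {m∣x-y : True (m ∣? x - y)} → x ≡ y mod m
  mod-decide {m∣x-y = m∣x-y} = mod-∣ (toWitness m∣x-y)

  mod-refl : ∀ {m} x → x ≡ x mod m
  mod-refl x = mod-∣ (divides (+ 0) (ℤ.+-inverseʳ x))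

  mod-trans : ∀ {m x y z} → x ≡ y mod m → y ≡ z mod m → x ≡ z mod m
  mod-trans {m} {x} {y} {z} (mod-∣ x≡y) (mod-∣ y≡z) =
    mod-∣ (subst (m ∣_) (telescope x y z) (∣m∣n⇒∣m+n x≡y y≡z))
    where
    telescope : ∀ x y z → (x - y) + (y - z) ≡ x - z
    telescope = solve-∀

  mod-+ : ∀ {m x x′ y y′} → x ≡ x′ mod m → y ≡ y′ mod m → x + y ≡ x′ + y′ mod m
  mod-+ {m} {x} {x′} {y} {y′} (mod-∣ x≡x′) (mod-∣ y≡y′) =
    mod-∣ (subst (m ∣_) (split x x′ y y′) (∣m∣n⇒∣m+n x≡x′ y≡y′))
    where
    split : ∀ x x′ y y′ → (x - x′) + (y - y′) ≡ (x + y) - (x′ + y′)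
    split = solve-∀

  mod-* : ∀ {m x x′ y y′} → x ≡ x′ mod m → y ≡ y′ mod m → x * y ≡ x′ * y′ mod m
  mod-* {m} {x} {x′} {y} {y′} (mod-∣ x≡x′) (mod-∣ y≡y′) =
    mod-∣ (subst (m ∣_) (split x x′ y y′) (∣m∣n⇒∣m+n (∣n⇒∣m*n x y≡y′) (∣n⇒∣m*n y′ x≡x′)))
    where
    split : ∀ x x′ y y′ → x * (y - y′) + y′ * (x - x′) ≡ x * y - x′ * y′
    split = solve-∀

  mod-weaken : ∀ {d m x y} → d ∣ m → x ≡ y mod m → x ≡ y mod d
  mod-weaken d∣m (mod-∣ m∣x-y) = mod-∣ (∣-trans d∣m m∣x-y)

  mod-factor : ∀ {x} m s → x ≡ m mod (s * m) → ∃[ w ] (x ≡ m * w) × (w ≡ + 1 mod s)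
  mod-factor {x} m s (mod-∣ (divides q x-m≡q*s*m)) = + 1 + q * s , x≡m*w , mod-∣ (divides q (cancel q s))
    where
    regroup : ∀ x m → x ≡ (x - m) + m
    regroup = solve-∀
    factor : ∀ q s m → q * (s * m) + m ≡ m * (+ 1 + q * s)
    factor = solve-∀
    cancel : ∀ q s → (+ 1 + q * s) - + 1 ≡ q * s
    cancel = solve-∀
    x≡m*w : x ≡ m * (+ 1 + q * s)
    x≡m*w = begin
      x                   ≡⟨ regroup x m ⟩
      (x - m) + m         ≡⟨ cong (_+ m) x-m≡q*s*m ⟩
      q * (s * m) + m     ≡⟨ factor q s m ⟩
      m * (+ 1 + q * s)   ∎

  record Quadratic : Set where
    constructor quadratic
    field c₀ c₁ c₂ : ℤ

  ⟦_⟧ : Quadratic → ℤ → ℤ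
  ⟦ quadratic c₀ c₁ c₂ ⟧ ν = c₀ + c₁ * ν + c₂ * (ν * ν)

  ⟦⟧-mod : ∀ {m ν ν′} (q : Quadratic) → ν ≡ ν′ mod m → ⟦ q ⟧ ν ≡ ⟦ q ⟧ ν′ mod m
  ⟦⟧-mod (quadratic c₀ c₁ c₂) ν≡ν′ =
    mod-+ (mod-+ (mod-refl c₀) (mod-* (mod-refl c₁) ν≡ν′)) (mod-* (mod-refl c₂) (mod-* ν≡ν′ ν≡ν′))

  Recurrence⁺ Recurrence⁻ : (ℕ → ℤ) → Set
  Recurrence⁺ u = ∀ n → u (2 ℕ.+ n) ≡ u (1 ℕ.+ n) + + (1 ℕ.+ n) * u n
  Recurrence⁻ u = ∀ n → u (2 ℕ.+ n) ≡ u (1 ℕ.+ n) - + (1 ℕ.+ n) * u n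

  record FourStep (u : ℕ → ℤ) : Set where
    field
      a b c d : Quadratic
      step₀ : ∀ n → u (4 ℕ.+ 2 ℕ.* n) ≡
                    + 2 * (⟦ a ⟧ (+ n) * u (2 ℕ.* n) + ⟦ b ⟧ (+ n) * u (1 ℕ.+ 2 ℕ.* n))
      step₁ : ∀ n → u (5 ℕ.+ 2 ℕ.* n) ≡
                    + 2 * (⟦ c ⟧ (+ n) * u (2 ℕ.* n) + ⟦ d ⟧ (+ n) * u (1 ℕ.+ 2 ℕ.* n))

    row₀ row₁ : ℤ → ℤ → ℤ → ℤ
    row₀ ν x y = ⟦ a ⟧ ν * x + ⟦ b ⟧ ν * y
    row₁ ν x y = ⟦ c ⟧ ν * x + ⟦ d ⟧ ν * y

    row₀-mod : ∀ {m ν ν′ x x′ y y′} → ν ≡ ν′ mod m → x ≡ x′ mod m → y ≡ y′ mod m →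
               row₀ ν x y ≡ row₀ ν′ x′ y′ mod m
    row₀-mod ν≡ν′ x≡x′ y≡y′ = mod-+ (mod-* (⟦⟧-mod a ν≡ν′) x≡x′) (mod-* (⟦⟧-mod b ν≡ν′) y≡y′)

    row₁-mod : ∀ {m ν ν′ x x′ y y′} → ν ≡ ν′ mod m → x ≡ x′ mod m → y ≡ y′ mod m →
               row₁ ν x y ≡ row₁ ν′ x′ y′ mod m
    row₁-mod ν≡ν′ x≡x′ y≡y′ = mod-+ (mod-* (⟦⟧-mod c ν≡ν′) x≡x′) (mod-* (⟦⟧-mod d ν≡ν′) y≡y′)

  pos-i+2n : ∀ i n → + (i ℕ.+ 2 ℕ.* n) ≡ + i + + 2 * + n
  pos-i+2n i n = cong (λ c → + i + c) (ℤ.pos-* 2 n)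

  -- The coefficients come from expanding u₄ and u₅; the common factor 2 appears because the
  -- starting index 2n is even.
  four-step⁺ : ∀ {u} → Recurrence⁺ u → FourStep u
  four-step⁺ {u} rec = record
    { a = quadratic (+ 2) (+ 5) (+ 2) ; b = quadratic (+ 3) (+ 2) (+ 0)
    ; c = quadratic (+ 4) (+ 10) (+ 4) ; d = quadratic (+ 9) (+ 9) (+ 2)
    ; step₀ = λ n → proj₁ (expand (+ n) _ _ _ _ _ _ (rec′ 0 n) (rec′ 1 n) (rec′ 2 n) (rec′ 3 n))
    ; step₁ = λ n → proj₂ (expand (+ n) _ _ _ _ _ _ (rec′ 0 n) (rec′ 1 n) (rec′ 2 n) (rec′ 3 n))
    }
    where
    rec′ : ∀ i n → u (2 ℕ.+ i ℕ.+ 2 ℕ.* n) ≡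
                   u (1 ℕ.+ i ℕ.+ 2 ℕ.* n) + (+ (1 ℕ.+ i) + + 2 * + n) * u (i ℕ.+ 2 ℕ.* n)
    rec′ i n = trans (rec (i ℕ.+ 2 ℕ.* n))
                     (cong (λ c → u (1 ℕ.+ i ℕ.+ 2 ℕ.* n) + c * u (i ℕ.+ 2 ℕ.* n)) (pos-i+2n (1 ℕ.+ i) n))
    expand : ∀ ν u₀ u₁ u₂ u₃ u₄ u₅ →
      u₂ ≡ u₁ + (+ 1 + + 2 * ν) * u₀ → u₃ ≡ u₂ + (+ 2 + + 2 * ν) * u₁ →
      u₄ ≡ u₃ + (+ 3 + + 2 * ν) * u₂ → u₅ ≡ u₄ + (+ 4 + + 2 * ν) * u₃ →
      (u₄ ≡ + 2 * ((+ 2 + + 5 * ν + + 2 * (ν * ν)) * u₀ + (+ 3 + + 2 * ν + + 0 * (ν * ν)) * u₁)) ×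
      (u₅ ≡ + 2 * ((+ 4 + + 10 * ν + + 4 * (ν * ν)) * u₀ + (+ 9 + + 9 * ν + + 2 * (ν * ν)) * u₁))
    expand ν u₀ u₁ _ _ _ _ refl refl refl refl = solve (ν ∷ u₀ ∷ u₁ ∷ []) , solve (ν ∷ u₀ ∷ u₁ ∷ [])

  four-step⁻ : ∀ {u} → Recurrence⁻ u → FourStep u
  four-step⁻ {u} rec = record
    { a = quadratic (+ 1) (+ 3) (+ 2) ; b = quadratic (- + 2) (- + 2) (+ 0)
    ; c = quadratic (+ 3) (+ 8) (+ 4) ; d = quadratic (+ 0) (+ 3) (+ 2)
    ; step₀ = λ n → proj₁ (expand (+ n) _ _ _ _ _ _ (rec′ 0 n) (rec′ 1 n) (rec′ 2 n) (rec′ 3 n))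
    ; step₁ = λ n → proj₂ (expand (+ n) _ _ _ _ _ _ (rec′ 0 n) (rec′ 1 n) (rec′ 2 n) (rec′ 3 n))
    }
    where
    rec′ : ∀ i n → u (2 ℕ.+ i ℕ.+ 2 ℕ.* n) ≡
                   u (1 ℕ.+ i ℕ.+ 2 ℕ.* n) - (+ (1 ℕ.+ i) + + 2 * + n) * u (i ℕ.+ 2 ℕ.* n)
    rec′ i n = trans (rec (i ℕ.+ 2 ℕ.* n))
                     (cong (λ c → u (1 ℕ.+ i ℕ.+ 2 ℕ.* n) - c * u (i ℕ.+ 2 ℕ.* n)) (pos-i+2n (1 ℕ.+ i) n))
    expand : ∀ ν u₀ u₁ u₂ u₃ u₄ u₅ →
      u₂ ≡ u₁ - (+ 1 + + 2 * ν) * u₀ → u₃ ≡ u₂ - (+ 2 + + 2 * ν) * u₁ →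
      u₄ ≡ u₃ - (+ 3 + + 2 * ν) * u₂ → u₅ ≡ u₄ - (+ 4 + + 2 * ν) * u₃ →
      (u₄ ≡ + 2 * ((+ 1 + + 3 * ν + + 2 * (ν * ν)) * u₀ + (- + 2 + - + 2 * ν + + 0 * (ν * ν)) * u₁)) ×
      (u₅ ≡ + 2 * ((+ 3 + + 8 * ν + + 4 * (ν * ν)) * u₀ + (+ 0 + + 3 * ν + + 2 * (ν * ν)) * u₁))
    expand ν u₀ u₁ _ _ _ _ refl refl refl refl = solve (ν ∷ u₀ ∷ u₁ ∷ []) , solve (ν ∷ u₀ ∷ u₁ ∷ [])

  total signed : ℕ → ℤ
  total n  = + involutions 0ℙ n + + involutions 1ℙ n
  signed n = + involutions 0ℙ n - + involutions 1ℙ n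

  involutions-recℤ : ∀ p n → + involutions p (2 ℕ.+ n) ≡
                             + involutions p (1 ℕ.+ n) + + (1 ℕ.+ n) * + involutions (p ⁻¹) n
  involutions-recℤ p n = trans (cong +_ (involutions-rec p n))
                               (cong (λ x → + involutions p (1 ℕ.+ n) + x) (ℤ.pos-* (1 ℕ.+ n) _))

  module _ (n : ℕ) where

    private
      e₁ o₁ e₀ o₀ : ℤ
      e₁ = + involutions 0ℙ (1 ℕ.+ n)
      o₁ = + involutions 1ℙ (1 ℕ.+ n)
      e₀ = + involutions 0ℙ n
      o₀ = + involutions 1ℙ n

    total-rec : total (2 ℕ.+ n) ≡ total (1 ℕ.+ n) + + (1 ℕ.+ n) * total n
    total-rec = trans (cong₂ _+_ (involutions-recℤ 0ℙ n) (involutions-recℤ 1ℙ n))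
                      (regroup e₁ o₁ e₀ o₀ (+ (1 ℕ.+ n)))
      where
      regroup : ∀ e₁ o₁ e₀ o₀ m → (e₁ + m * o₀) + (o₁ + m * e₀) ≡ (e₁ + o₁) + m * (e₀ + o₀)
      regroup = solve-∀

    signed-rec : signed (2 ℕ.+ n) ≡ signed (1 ℕ.+ n) - + (1 ℕ.+ n) * signed n
    signed-rec = trans (cong₂ _-_ (involutions-recℤ 0ℙ n) (involutions-recℤ 1ℙ n))
                       (regroup e₁ o₁ e₀ o₀ (+ (1 ℕ.+ n)))
      where
      regroup : ∀ e₁ o₁ e₀ o₀ m → (e₁ + m * o₀) - (o₁ + m * e₀) ≡ (e₁ - o₁) - m * (e₀ - o₀)
      regroup = solve-∀

  record Profile (u : ℕ → ℤ) (k : ℕ) (x y : ℤ) : Set where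
    constructor profile
    field
      w₀ w₁ : ℤ
      u₀≡ : u (4 ℕ.* k) ≡ (+ 2) ^ k * w₀
      u₁≡ : u (1 ℕ.+ 4 ℕ.* k) ≡ (+ 2) ^ k * w₁
      w₀≡x : w₀ ≡ x mod + 8
      w₁≡y : w₁ ≡ y mod + 8

  profile-resp : ∀ {u k x y x′ y′} → x ≡ x′ mod + 8 → y ≡ y′ mod + 8 →
                 Profile u k x y → Profile u k x′ y′
  profile-resp x≡x′ y≡y′ (profile w₀ w₁ u₀≡ u₁≡ w₀≡x w₁≡y) =
    profile w₀ w₁ u₀≡ u₁≡ (mod-trans w₀≡x x≡x′) (mod-trans w₁≡y y≡y′)

  profile-step : ∀ {u k x y} (F : FourStep u) → let open FourStep F ; ν = + (2 ℕ.* k) in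
                 Profile u k x y → Profile u (suc k) (row₀ ν x y) (row₁ ν x y)
  profile-step {u} {k} F (profile w₀ w₁ u₀≡ u₁≡ w₀≡x w₁≡y) =
    profile (row₀ ν w₀ w₁) (row₁ ν w₀ w₁)
            (advance 0 a b (step₀ (2 ℕ.* k))) (advance 1 c d (step₁ (2 ℕ.* k)))
            (row₀-mod (mod-refl ν) w₀≡x w₁≡y) (row₁-mod (mod-refl ν) w₀≡x w₁≡y)
    where
    open FourStep F
    ν = + (2 ℕ.* k)
    index : ∀ i k → i ℕ.+ 4 ℕ.* (1 ℕ.+ k) ≡ 4 ℕ.+ i ℕ.+ 2 ℕ.* (2 ℕ.* k)
    index = ℕ-solve-∀
    factor : ∀ p q x w₀ w₁ → + 2 * (p * (x * w₀) + q * (x * w₁)) ≡ + 2 * x * (p * w₀ + q * w₁)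
    factor = solve-∀
    advance : ∀ i p q →
              u (4 ℕ.+ i ℕ.+ 2 ℕ.* (2 ℕ.* k)) ≡
                + 2 * (⟦ p ⟧ ν * u (2 ℕ.* (2 ℕ.* k)) + ⟦ q ⟧ ν * u (1 ℕ.+ 2 ℕ.* (2 ℕ.* k))) →
              u (i ℕ.+ 4 ℕ.* suc k) ≡ (+ 2) ^ suc k * (⟦ p ⟧ ν * w₀ + ⟦ q ⟧ ν * w₁)
    advance i p q step = begin
      u (i ℕ.+ 4 ℕ.* suc k)
        ≡⟨ cong u (index i k) ⟩
      u (4 ℕ.+ i ℕ.+ 2 ℕ.* (2 ℕ.* k))
        ≡⟨ step ⟩
      + 2 * (⟦ p ⟧ ν * u (2 ℕ.* (2 ℕ.* k)) + ⟦ q ⟧ ν * u (1 ℕ.+ 2 ℕ.* (2 ℕ.* k)))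
        ≡⟨ cong (λ m → + 2 * (⟦ p ⟧ ν * u m + ⟦ q ⟧ ν * u (1 ℕ.+ m))) (ℕ.*-assoc 2 2 k) ⟨
      + 2 * (⟦ p ⟧ ν * u (4 ℕ.* k) + ⟦ q ⟧ ν * u (1 ℕ.+ 4 ℕ.* k))
        ≡⟨ cong₂ (λ v₀ v₁ → + 2 * (⟦ p ⟧ ν * v₀ + ⟦ q ⟧ ν * v₁)) u₀≡ u₁≡ ⟩
      + 2 * (⟦ p ⟧ ν * ((+ 2) ^ k * w₀) + ⟦ q ⟧ ν * ((+ 2) ^ k * w₁))
        ≡⟨ factor (⟦ p ⟧ ν) (⟦ q ⟧ ν) ((+ 2) ^ k) w₀ w₁ ⟩
      (+ 2) ^ suc k * (⟦ p ⟧ ν * w₀ + ⟦ q ⟧ ν * w₁) ∎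

  period4 : ℤ → ℤ → ℤ → ℤ → ℕ → ℤ
  period4 r₀ r₁ r₂ r₃ 0 = r₀
  period4 r₀ r₁ r₂ r₃ 1 = r₁
  period4 r₀ r₁ r₂ r₃ 2 = r₂
  period4 r₀ r₁ r₂ r₃ 3 = r₃
  period4 r₀ r₁ r₂ r₃ (suc (suc (suc (suc k)))) = period4 r₀ r₁ r₂ r₃ k

  -- Residues mod 8 of the odd parts in the profiles of total (at 4k and 4k+1 alike) and of signed
  -- (at 4k and at 4k+1), read off from small k.
  τ σ₀ σ₁ : ℕ → ℤ
  τ  = period4 (+ 1) (+ 5) (+ 7) (+ 7)
  σ₀ = period4 (+ 1) (+ 7) (+ 7) (+ 5)
  σ₁ = period4 (+ 1) (+ 3) (+ 7) (+ 1)

  total-four-step : FourStep total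
  total-four-step = four-step⁺ total-rec

  signed-four-step : FourStep signed
  signed-four-step = four-step⁻ signed-rec

  module Total⁴ = FourStep total-four-step
  module Signed⁴ = FourStep signed-four-step

  ResidueStep : ℕ → Set
  ResidueStep k = (Total⁴.row₀ ν (τ k) (τ k) ≡ τ (suc k) mod + 8) ×
                  (Total⁴.row₁ ν (τ k) (τ k) ≡ τ (suc k) mod + 8) ×
                  (Signed⁴.row₀ ν (σ₀ k) (σ₁ k) ≡ σ₀ (suc k) mod + 8) ×
                  (Signed⁴.row₁ ν (σ₀ k) (σ₁ k) ≡ σ₁ (suc k) mod + 8)
    where ν = + (2 ℕ.* k)

  residue-step : ∀ k → ResidueStep k
  residue-step 0 = mod-decide , mod-decide , mod-decide , mod-decide
  residue-step 1 = mod-decide , mod-decide , mod-decide , mod-decide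
  residue-step 2 = mod-decide , mod-decide , mod-decide , mod-decide
  residue-step 3 = mod-decide , mod-decide , mod-decide , mod-decide
  residue-step (suc (suc (suc (suc k)))) with residue-step k
  ... | t₀ , t₁ , s₀ , s₁ =
    mod-trans (Total⁴.row₀-mod shift (mod-refl (τ k)) (mod-refl (τ k))) t₀ ,
    mod-trans (Total⁴.row₁-mod shift (mod-refl (τ k)) (mod-refl (τ k))) t₁ ,
    mod-trans (Signed⁴.row₀-mod shift (mod-refl (σ₀ k)) (mod-refl (σ₁ k))) s₀ ,
    mod-trans (Signed⁴.row₁-mod shift (mod-refl (σ₀ k)) (mod-refl (σ₁ k))) s₁
    where
    shift : + (2 ℕ.* (4 ℕ.+ k)) ≡ + (2 ℕ.* k) mod + 8
    shift = mod-∣ (divides (+ 1)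
      (trans (cong (λ m → + m - + (2 ℕ.* k)) (ℕ.*-distribˡ-+ 2 4 k)) (cancel (+ (2 ℕ.* k)))))
      where
      cancel : ∀ x → (+ 8 + x) - x ≡ + 1 * + 8
      cancel = solve-∀

  Profiles : ℕ → Set
  Profiles k = Profile total k (τ k) (τ k) × Profile signed k (σ₀ k) (σ₁ k)

  profiles : ∀ k → Profiles k
  profiles zero = profile (+ 1) (+ 1) refl refl (mod-refl _) (mod-refl _) ,
                  profile (+ 1) (+ 1) refl refl (mod-refl _) (mod-refl _)
  profiles (suc k) with profiles k | residue-step k
  ... | total-profile , signed-profile | t₀ , t₁ , s₀ , s₁ =
    profile-resp t₀ t₁ (profile-step total-four-step total-profile) ,
    profile-resp s₀ s₁ (profile-step signed-four-step signed-profile)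

  pos-^ : ∀ m e → + (m ℕ.^ e) ≡ (+ m) ^ e
  pos-^ m zero    = refl
  pos-^ m (suc e) = trans (ℤ.pos-* m (m ℕ.^ e)) (cong (+ m *_) (pos-^ m e))

  ord₂-odd : ∀ {n e w} → + n ≡ (+ 2) ^ e * w → w ≡ + 1 mod + 2 → Ord₂ n e
  ord₂-odd {n} {e} {w} n≡2^e*w (mod-∣ 2∣w-1) =
    ℕᵈ.divides ∣ w ∣ (trans n≡2^e*∣w∣ (ℕ.*-comm (2 ℕ.^ e) ∣ w ∣)) , not-divides
    where
    n≡2^e*∣w∣ : n ≡ 2 ℕ.^ e ℕ.* ∣ w ∣
    n≡2^e*∣w∣ = trans (cong ∣_∣ (trans n≡2^e*w (cong (_* w) (sym (pos-^ 2 e)))))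
                      (ℤ.abs-* (+ (2 ℕ.^ e)) w)
    w-[w-1] : ∀ w → w - (w - + 1) ≡ + 1
    w-[w-1] = solve-∀
    reorder : ∀ q p → q ℕ.* (2 ℕ.* p) ≡ p ℕ.* (q ℕ.* 2)
    reorder = ℕ-solve-∀
    not-divides : ¬ (2 ℕ.^ suc e ℕᵈ.∣ n)
    not-divides (ℕᵈ.divides q n≡q*2^[1+e]) = contradiction (ℕᵈ.∣1⇒≡1 (∣⇒∣ᵤ 2∣1)) λ ()
      where
      ∣w∣≡q*2 : ∣ w ∣ ≡ q ℕ.* 2
      ∣w∣≡q*2 = ℕ.*-cancelˡ-≡ ∣ w ∣ (q ℕ.* 2) (2 ℕ.^ e) {{ℕ.m^n≢0 2 e}}
        (trans (sym n≡2^e*∣w∣) (trans n≡q*2^[1+e] (reorder q (2 ℕ.^ e))))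
      2∣w : + 2 ∣ w
      2∣w = ∣ᵤ⇒∣ (ℕᵈ.divides q ∣w∣≡q*2)
      2∣1 : + 2 ∣ + 1
      2∣1 = subst (+ 2 ∣_) (w-[w-1] w) (∣m∣n⇒∣m-n 2∣w 2∣w-1)

  ord₂-of-double : ∀ {n k e s} → + 2 * + n ≡ (+ 2) ^ k * s → s ≡ (+ 2) ^ suc e mod (+ 2) ^ (2 ℕ.+ e) →
                   Ord₂ n (k ℕ.+ e)
  ord₂-of-double {n} {k} {e} {s} 2n≡2^k*s s≡2^[1+e] with mod-factor ((+ 2) ^ suc e) (+ 2) s≡2^[1+e]
  ... | w , s≡2^[1+e]*w , w≡1 = ord₂-odd {e = k ℕ.+ e} (ℤ.*-cancelˡ-≡ (+ 2) (+ n) _ (begin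
    + 2 * + n                          ≡⟨ 2n≡2^k*s ⟩
    (+ 2) ^ k * s                      ≡⟨ cong ((+ 2) ^ k *_) s≡2^[1+e]*w ⟩
    (+ 2) ^ k * ((+ 2) ^ suc e * w)    ≡⟨ ℤ.*-assoc ((+ 2) ^ k) ((+ 2) ^ suc e) w ⟨
    (+ 2) ^ k * (+ 2) ^ suc e * w      ≡⟨ cong (_* w) (ℤ.^-distribˡ-+-* (+ 2) k (suc e)) ⟨
    (+ 2) ^ (k ℕ.+ suc e) * w          ≡⟨ cong (λ m → (+ 2) ^ m * w) (ℕ.+-suc k e) ⟩
    + 2 * (+ 2) ^ (k ℕ.+ e) * w        ≡⟨ ℤ.*-assoc (+ 2) ((+ 2) ^ (k ℕ.+ e)) w ⟩
    + 2 * ((+ 2) ^ (k ℕ.+ e) * w)      ∎)) w≡1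

  -- τ k + σ₀ k runs through 2, 12, 14, 12: exactly divisible by 2 for even k and by 4 for odd k.
  sum-residue : ∀ k {w} → w ≡ τ k + σ₀ k mod + 8 → w ≡ (+ 2) ^ suc (χₒ k) mod (+ 2) ^ (2 ℕ.+ χₒ k)
  sum-residue 0 w≡ = mod-trans (mod-weaken (divides (+ 2) refl) w≡) mod-decide
  sum-residue 1 w≡ = mod-trans w≡ mod-decide
  sum-residue 2 w≡ = mod-trans (mod-weaken (divides (+ 2) refl) w≡) mod-decide
  sum-residue 3 w≡ = mod-trans w≡ mod-decide
  sum-residue (suc (suc (suc (suc k)))) = sum-residue k

  ord₂-involutions : ∀ k → Ord₂ (involutions 0ℙ (4 ℕ.* k)) (k ℕ.+ χₒ k)
  ord₂-involutions k with profiles k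
  ... | profile a _ total≡2^k*a _ a≡τ _ , profile c _ signed≡2^k*c _ c≡σ₀ _ =
    ord₂-of-double {k = k} {e = χₒ k} 2e≡2^k*[a+c] (sum-residue k (mod-+ a≡τ c≡σ₀))
    where
    e = + involutions 0ℙ (4 ℕ.* k)
    o = + involutions 1ℙ (4 ℕ.* k)
    double : ∀ e o → + 2 * e ≡ (e + o) + (e - o)
    double = solve-∀
    2e≡2^k*[a+c] : + 2 * e ≡ (+ 2) ^ k * (a + c)
    2e≡2^k*[a+c] = begin
      + 2 * e                              ≡⟨ double e o ⟩
      total (4 ℕ.* k) + signed (4 ℕ.* k)   ≡⟨ cong₂ _+_ total≡2^k*a signed≡2^k*c ⟩
      (+ 2) ^ k * a + (+ 2) ^ k * c        ≡⟨ ℤ.*-distribˡ-+ ((+ 2) ^ k) a c ⟨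
      (+ 2) ^ k * (a + c)                  ∎

open Involutions using (tᵉ≡involutions)
open TwoAdic using (ord₂-involutions)
open import Data.Nat using (ℕ; suc; _+_; _*_; _/_; s≤s; z≤n)
open import Data.Nat.DivMod using (m/n≡1+[m∸n]/n)
open import Data.Nat.Properties using (*-suc)
open import Data.Product using (_×_; _,_)
open import Relation.Binary.PropositionalEquality
  using (_≡_; refl; sym; cong; subst₂; module ≡-Reasoning)
open ≡-Reasoning

half-rounding : ∀ k → 2 * ((k + 1) / 2) ≡ k + χₒ k
half-rounding 0 = refl
half-rounding 1 = refl
half-rounding (suc (suc k)) = begin
  2 * ((2 + k + 1) / 2)     ≡⟨ cong (2 *_) (m/n≡1+[m∸n]/n {2 + k + 1} (s≤s (s≤s z≤n))) ⟩
  2 * (1 + (k + 1) / 2)     ≡⟨ *-suc 2 ((k + 1) / 2) ⟩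
  2 + 2 * ((k + 1) / 2)     ≡⟨ cong (2 +_) (half-rounding k) ⟩
  2 + (k + χₒ k)            ∎

theorem5p4 : (k : ℕ) →
    Ord₂ (tᵉ (4 * k)) (2 * ((k + 1) / 2)) × (2 * ((k + 1) / 2) ≡ k + χₒ k)
theorem5p4 k =
  subst₂ Ord₂ (sym (tᵉ≡involutions (4 * k))) (sym (half-rounding k)) (ord₂-involutions k) ,
  half-rounding k
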